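{- There exist ADB graphs that are not annular connected (i.e. not ADB-AC graphs).
   Context: A Barnette graph is a finite $3$-regular, $3$-connected, planar, bipartite graph. A Barnette graph $G$ is an $x$-ADB graph if it has a plane embedding with pairwise vertex-disjoint cycles $C_0,C_1,\dots,C_x$ of $G$, each $C_{k-1}$ lying in the bounded region of $C_k$, such that $C_0$ bounds a face, $C_x$ bounds the unbounded face, every vertex lies on some $C_k$, and every edge is either an edge of some $C_k$ or joins a vertex of $C_{k-1}$ to a vertex of $C_k$ for some $1\le k\le x$. The closed region between $C_{k-1}$ and $C_k$ is the $k$-th annulus $A_k$, and edges joining $C_{k-1}$ to $C_k$ lie in its interior. Suppressing degree-$2$ vertices means replacing each maximal path whose internal vertices have degree $2$ by a single edge (a cycle all of whose vertices have degree $2$ becomes a vertex-less closed curve). An $x$-ADB graph with $x>2$ is annular connected (ADB-AC) if for every $k$, deleting the edges in the interior of $A_k$ and suppressing degree-$2$ vertices yields either two Barnette graphs or a Barnette graph and a vertex-less closed curve. -}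

module Defs where

import Level
open Level using (Lift)
open import Data.Nat using (ℕ; zero; suc; _+_; _*_; _≤_; _<_)
open import Data.Fin using (Fin; zero; suc; toℕ; inject₁)
open import Data.Product using (Σ; ∃; ∃-syntax; _×_; _,_; proj₁; proj₂)
open import Data.Sum using (_⊎_)
open import Data.Unit using (⊤)
open import Data.List using (List; []; _∷_; _++_; length)
open import Data.List.Relation.Unary.All using (All)
open import Data.List.Relation.Unary.Linked using (Linked)
open import Data.List.Relation.Unary.Unique.Propositional using (Unique)
open import Data.List.Membership.Propositional using (_∈_)
open import Relation.Binary.PropositionalEquality using (_≡_; _≢_)
open import Relation.Binary.Construct.Closure.ReflexiveTransitive using (Star)
open import Relation.Nullary using (¬_)

record Graph : Set₁ where
  field
    n     : ℕ
    E     : Fin n → Fin n → Set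
    sym   : ∀ {u v} → E u v → E v u
    irrefl : ∀ {u} → ¬ E u u
open Graph public

module _ (G : Graph) where
  private V = Fin (n G)

  data Walk (P : V → Set) : V → V → Set where
    here : ∀ {u} → P u → Walk P u u
    step : ∀ {u w v} → P u → E G u w → Walk P w v → Walk P u v

  DegIs : (P : V → Set) → V → ℕ → Set
  DegIs P v d = Σ (Fin d → V) λ g →
      (∀ i j → g i ≡ g j → i ≡ j)
    × (∀ i → P (g i) × E G v (g i))
    × (∀ w → P w → E G v w → ∃[ i ] g i ≡ w)

  Cubic : Set
  Cubic = ∀ v → DegIs (λ _ → ⊤) v 3

  Bipartite : Set
  Bipartite = Σ (V → Fin 2) λ c → ∀ u v → E G u v → c u ≢ c v

  ConnectedOn : (V → Set) → Set
  ConnectedOn P = ∀ u v → P u → P v → Walk P u v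

  Connected : Set
  Connected = ConnectedOn (λ _ → ⊤)

  -- 3-connected: more than 3 vertices, and deleting any set of at most
  -- two vertices {a,b} (a ≡ b allowed) leaves a connected graph
  ThreeConnected : Set
  ThreeConnected = 3 < n G ×
    (∀ (a b : V) → ConnectedOn (λ z → z ≢ a × z ≢ b))

  Dart : Set
  Dart = V × V

  IsDart : Dart → Set
  IsDart (u , w) = E G u w

  -- rot v is a cyclic permutation of the neighbourhood of v
  -- (on a 3-element set: fixed-point-free with rot³ = id)
  IsRotation : (V → V → V) → Set
  IsRotation rot = ∀ v w → E G v w →
    E G v (rot v w) × rot v w ≢ w × rot v (rot v (rot v w)) ≡ w

  faceSucc : (V → V → V) → Dart → Dart
  faceSucc rot (u , w) = (w , rot w u)

  iter : {A : Set} → (A → A) → ℕ → A → A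
  iter f zero a = a
  iter f (suc k) a = f (iter f k a)

  InOrbit : (V → V → V) → Dart → Dart → Set
  InOrbit rot d e = ∃[ k ] iter (faceSucc rot) k d ≡ e

  FaceCount : (V → V → V) → ℕ → Set
  FaceCount rot F = Σ (Fin F → Dart) λ rep →
      (∀ i → IsDart (rep i))
    × (∀ i j → InOrbit rot (rep i) (rep j) → i ≡ j)
    × (∀ d → IsDart d → ∃[ i ] InOrbit rot (rep i) d)

  -- a genus-0 rotation system of a connected cubic graph:
  -- Euler's formula  n - |E| + F = 2  with 2|E| = 3n, i.e. 2(n + F) = 4 + 3n
  Spherical : (V → V → V) → Set
  Spherical rot = IsRotation rot ×
    (∃[ F ] FaceCount rot F × 2 * (n G + F) ≡ 4 + 3 * n G)

  PlanarCubic : Set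
  PlanarCubic = ∃[ rot ] Spherical rot

  IsBarnette : Set
  IsBarnette = Cubic × ThreeConnected × PlanarCubic × Bipartite

module _ (G : Graph) where
  private V = Fin (n G)

  HE : (V → Set) → V → V → Set
  HE P u w = P u × P w × E G u w

  Branch : (V → Set) → V → Set
  Branch P v = P v × ¬ DegIs G P v 2

  -- a thread: a path u, mid..., w in G[P] (u ≢ w) with all internal vertices
  -- of degree 2 in G[P]; it becomes an edge uw after suppression
  Thread : (V → Set) → V → V → List V → Set
  Thread P u w mid = Linked (HE P) (u ∷ mid ++ w ∷ [])
    × All (λ v → DegIs G P v 2) mid
    × Unique (u ∷ mid ++ w ∷ [])

  -- a closed thread through u (would become a loop at u)
  LoopThread : (V → Set) → V → List V → Set
  LoopThread P u mid = Linked (HE P) (u ∷ mid ++ u ∷ [])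
    × All (λ v → DegIs G P v 2) mid
    × Unique (u ∷ mid)
    × 2 ≤ length mid

  -- suppressing degree-2 vertices of G[P] yields (a copy of) the simple graph B:
  -- f identifies V(B) with the branch vertices, edges of B correspond exactly
  -- and uniquely to threads, there are no loops, and no degree-2 vertex is
  -- left over (i.e. no vertex-less closed curves arise)
  SuppressesTo : (V → Set) → Graph → Set
  SuppressesTo P B = Σ (Fin (n B) → V) λ f →
      (∀ a b → f a ≡ f b → a ≡ b)
    × (∀ a → Branch P (f a))
    × (∀ v → Branch P v → ∃[ a ] f a ≡ v)
    × (∀ a b → E B a b → ∃[ mid ] Thread P (f a) (f b) mid)
    × (∀ a b mid → Thread P (f a) (f b) mid → E B a b)
    × (∀ a b mid mid' → Thread P (f a) (f b) mid → Thread P (f a) (f b) mid' → mid ≡ mid')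
    × (∀ a mid → ¬ LoopThread P (f a) mid)
    × (∀ v → P v → DegIs G P v 2 → ∃[ a ] ∃[ b ] ∃[ mid ] Thread P (f a) (f b) mid × v ∈ mid)

  SuppressesToBarnette : (V → Set) → Set₁
  SuppressesToBarnette P = Σ Graph λ B → IsBarnette B × SuppressesTo P B

  -- suppressing degree-2 vertices of G[P] yields a single vertex-less closed
  -- curve: G[P] is nonempty, connected and 2-regular (a cycle)
  SuppressesToCurve : (V → Set) → Set
  SuppressesToCurve P = (∃[ v ] P v) × ConnectedOn G P × (∀ v → P v → DegIs G P v 2)

cycSucc : ∀ {m} → Fin m → Fin m
cycSucc {suc zero} zero = zero
cycSucc {suc (suc m)} zero = suc zero
cycSucc {suc (suc m)} (suc i) with cycSucc {suc m} i
... | zero = zero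
... | suc j = suc (suc j)

-- x-ADB structure on a graph G (with x + 1 cycles C_0, ..., C_x)

record ADB (G : Graph) (x : ℕ) : Set where
  private V = Fin (n G)
  field
    -- the plane embedding: a genus-0 rotation system, and a dart of the
    -- unbounded face
    rot       : V → V → V
    spherical : Spherical G rot
    outerDart : Dart G
    outerIsDart : IsDart G outerDart
    len     : Fin (suc x) → ℕ
    len≥3   : ∀ k → 3 ≤ len k
    cyc     : (k : Fin (suc x)) → Fin (len k) → V
    cyc-inj : ∀ k i j → cyc k i ≡ cyc k j → i ≡ j
    cyc-adj : ∀ k i → E G (cyc k i) (cyc k (cycSucc i))

  OnCyc : Fin (suc x) → V → Set
  OnCyc k v = ∃[ i ] cyc k i ≡ v

  CycEdge : Fin (suc x) → V → V → Set
  CycEdge k u w = ∃[ i ] ((cyc k i ≡ u × cyc k (cycSucc i) ≡ w)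
                        ⊎ (cyc k i ≡ w × cyc k (cycSucc i) ≡ u))

  Bounds : Fin (suc x) → Dart G → Set
  Bounds k d = IsDart G d × (∀ u w → E G u w →
    (CycEdge k u w → InOrbit G rot d (u , w) ⊎ InOrbit G rot d (w , u))
    × (InOrbit G rot d (u , w) ⊎ InOrbit G rot d (w , u) → CycEdge k u w))

  -- darts in the same region of the plane minus C_k: moves along a face,
  -- or across an edge not belonging to C_k
  SideStep : Fin (suc x) → Dart G → Dart G → Set
  SideStep k d e = IsDart G d × IsDart G e ×
    ( faceSucc G rot d ≡ e ⊎ faceSucc G rot e ≡ d
    ⊎ (e ≡ (proj₂ d , proj₁ d) × ¬ CycEdge k (proj₁ d) (proj₂ d)))

  SameSide : Fin (suc x) → Dart G → Dart G → Set
  SameSide k = Star (SideStep k)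

  field
    disjoint : ∀ k l i j → cyc k i ≡ cyc l j → k ≡ l
    cover    : ∀ v → ∃[ k ] OnCyc k v
    -- every edge is a cycle edge or joins C_{k-1} to C_k  (here k-1 = inject₁ j, k = suc j)
    edges    : ∀ u w → E G u w → (∃[ k ] CycEdge k u w)
      ⊎ (∃[ j ] ((OnCyc (inject₁ j) u × OnCyc (suc j) w) ⊎ (OnCyc (suc j) u × OnCyc (inject₁ j) w)))
    innerFace : ∃[ d ] Bounds zero d
    outerFace : Bounds (Data.Fin.fromℕ x) outerDart
    -- C_{k-1} lies in the bounded region of C_k: no dart at a vertex of
    -- C_{k-1} is in the region of C_k containing the unbounded face
    nested : ∀ (j : Fin x) i w → E G (cyc (inject₁ j) i) w →
      ¬ SameSide (suc j) (cyc (inject₁ j) i , w) outerDart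

-- annular connectivity (for the annulus A_{j+1} between C_j and C_{j+1})

module _ {G : Graph} {x : ℕ} (D : ADB G x) where
  open ADB D

  -- vertices inside / outside annulus A_{j+1}; the induced subgraphs on these
  -- are exactly what remains after deleting the edges interior to A_{j+1}
  Inner Outer : Fin x → Fin (n G) → Set
  Inner j v = ∃[ l ] toℕ l ≤ toℕ j × OnCyc l v
  Outer j v = ∃[ l ] toℕ j < toℕ l × OnCyc l v

  ACAt : Fin x → Set₁
  ACAt j =
      (SuppressesToBarnette G (Inner j) × SuppressesToBarnette G (Outer j))
    ⊎ (SuppressesToBarnette G (Inner j) × Lift (Level.suc Level.zero) (SuppressesToCurve G (Outer j)))
    ⊎ (Lift (Level.suc Level.zero) (SuppressesToCurve G (Inner j)) × SuppressesToBarnette G (Outer j))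


  AnnularConnected : Set₁
  AnnularConnected = ∀ j → ACAt j

{-# OPTIONS --safe #-}
module Submission where

-- The example has four nested cycles C₀ = 0‥3, C₁ = 4‥11, C₂ = 12‥19 and C₃ = 20‥23,
-- consecutive ones joined by four spokes.  Deleting the edges inside the outermost
-- annulus A₃ leaves C₀ ∪ C₁ ∪ C₂ with its spokes, in which 14, 15, 16 and 19 have
-- degree 2.  Suppressing them turns the path 13-14-15-16-17 into one edge, so the
-- 8-cycle 6-13-14-15-16-17-8-7 of the bipartite graph becomes a 5-cycle: the inner
-- side is not Barnette, and it is not a closed curve either, as 0 keeps degree 3.
-- Everything else is a finite check decided by evaluation.  The one check needing an
-- idea is the nesting of the cycles: labelling each dart by the annulus containing its
-- face gives a quantity that is constant along faces and changes only across cycle edges.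

open import Defs hiding (sym)
open import Level using (lift)
open import Data.Nat using (ℕ; zero; suc; _<_; _≤_; _≤?_; _⊔_; z≤n; s≤s) renaming (_≟_ to _≟ℕ_)
open import Data.Nat.Properties using (≤-antisym; ≤-trans; m≤n⇒m<n∨m≡n)
open import Data.Fin using (Fin; zero; suc; toℕ; fromℕ<; inject₁; #_)
open import Data.Fin.Properties using (_≟_; all?; any?; injective⇒≤; suc-injective; toℕ<n; toℕ-fromℕ<)
open import Data.Bool using (Bool; _∧_; _∨_; T; if_then_else_)
import Data.Bool.Properties as Bool
open import Data.Unit using (tt)
open import Data.Empty using (⊥; ⊥-elim)
open import Data.Product using (Σ; ∃-syntax; _×_; _,_; proj₁; proj₂)
import Data.Product as Product
import Data.Product.Properties as Product
open import Data.Sum using (_⊎_; inj₁; inj₂)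
import Data.Sum as Sum
open import Data.List using ([]; _∷_; _++_)
open import Data.List.Relation.Unary.All using (All; []; _∷_)
open import Data.List.Relation.Unary.Linked using (Linked; linked?)
open import Data.List.Relation.Unary.Unique.Propositional using (Unique)
import Data.List.Relation.Unary.Unique.DecPropositional as Unique
open import Data.Vec using (Vec; []; _∷_; lookup; tabulate)
import Data.Vec.Properties as Vec
open import Function using (_∘_; Equivalence)
open import Relation.Binary.PropositionalEquality
  using (_≡_; _≢_; refl; sym; trans; cong; subst; subst₂; module ≡-Reasoning)
open import Relation.Binary.Construct.Closure.ReflexiveTransitive using (Star; ε; _◅_)
open import Relation.Nullary using (¬_; Dec; yes; no)
open import Relation.Nullary.Decidable
  using (True; ⌊_⌋; toWitness; fromWitness; from-yes; T?; ¬?; _×-dec_; _⊎-dec_; _→-dec_)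
open import Relation.Unary using (Decidable)

module _ {G : Graph} {P : Fin (n G) → Set} where

  walk-source : ∀ {u v} → Walk G P u v → P u
  walk-source (here p) = p
  walk-source (step p _ _) = p

  walk-++ : ∀ {u v w} → Walk G P u v → Walk G P v w → Walk G P u w
  walk-++ (here _) q = q
  walk-++ (step p e r) q = step p e (walk-++ r q)

  walk-reverse : ∀ {u v} → Walk G P u v → Walk G P v u
  walk-reverse (here p) = here p
  walk-reverse (step p e r) = walk-++ (walk-reverse r) (step (walk-source r) (Graph.sym G e) (here p))

module _ (G : Graph) (v : Fin (n G)) where

  degIs-≤ : ∀ {P m m′} → DegIs G P v m → DegIs G P v m′ → m ≤ m′
  degIs-≤ {m = m} {m′} (g , g-inj , g-nb , _) (h , _ , _ , h-onto) = injective⇒≤ index-inj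
    where
    index : Fin m → Fin m′
    index i = proj₁ (h-onto (g i) (proj₁ (g-nb i)) (proj₂ (g-nb i)))

    h∘index : ∀ i → h (index i) ≡ g i
    h∘index i = proj₂ (h-onto (g i) (proj₁ (g-nb i)) (proj₂ (g-nb i)))

    index-inj : ∀ {i j} → index i ≡ index j → i ≡ j
    index-inj {i} {j} e = g-inj i j (trans (sym (h∘index i)) (trans (cong h e) (h∘index j)))

  degIs-unique : ∀ {P m m′} → DegIs G P v m → DegIs G P v m′ → m ≡ m′
  degIs-unique d d′ = ≤-antisym (degIs-≤ d d′) (degIs-≤ d′ d)

  degIs-restrict : ∀ {P Q m} (d : DegIs G Q v m) → (∀ {w} → P w → Q w) →
                   (∀ i → P (proj₁ d i)) → DegIs G P v m
  degIs-restrict (g , g-inj , g-nb , g-onto) P⊆Q P-g =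
    g , g-inj , (λ i → P-g i , proj₂ (g-nb i)) , λ w p e → g-onto w (P⊆Q p) e

  degIs-drop : ∀ {P Q m} (d : DegIs G Q v (suc m)) → (∀ {w} → P w → Q w) →
               ¬ P (proj₁ d zero) → (∀ i → P (proj₁ d (suc i))) → DegIs G P v m
  degIs-drop {P} (g , g-inj , g-nb , g-onto) P⊆Q ¬P-g₀ P-g =
    g ∘ suc , (λ i j e → suc-injective (g-inj _ _ e)) , (λ i → P-g i , proj₂ (g-nb (suc i))) , onto
    where
    onto : ∀ w → P w → E G v w → ∃[ i ] g (suc i) ≡ w
    onto w p e with g-onto w (P⊆Q p) e
    ... | zero , refl = ⊥-elim (¬P-g₀ p)
    ... | suc i , g-i = i , g-i

iter-periodic : ∀ (G : Graph) {A : Set} (f : A → A) {p a} → iter G f (suc p) a ≡ a →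
                ∀ k → ∃[ m ] m < suc p × iter G f k a ≡ iter G f m a
iter-periodic G f per zero = zero , s≤s z≤n , refl
iter-periodic G f per (suc k) with iter-periodic G f per k
... | m , s≤s m≤p , eq with m≤n⇒m<n∨m≡n m≤p
...   | inj₁ m<p  = suc m , s≤s m<p , cong f eq
...   | inj₂ refl = zero , s≤s z≤n , trans (cong f eq) per

module Faces (G : Graph) (rot : Fin (n G) → Fin (n G) → Fin (n G)) where

  private
    φ : Dart G → Dart G
    φ = faceSucc G rot

  OrbitWithin : ℕ → Dart G → Dart G → Set
  OrbitWithin L d e = ∃[ m ] iter G φ (toℕ {L} m) d ≡ e

  FaceLength≤ : ℕ → Dart G → Set
  FaceLength≤ L d = ∃[ p ] iter G φ (suc (toℕ {L} p)) d ≡ d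

  orbitWithin⇒inOrbit : ∀ {L d e} → OrbitWithin L d e → InOrbit G rot d e
  orbitWithin⇒inOrbit (m , eq) = toℕ m , eq

  inOrbit⇒orbitWithin : ∀ {L d e} → FaceLength≤ L d → InOrbit G rot d e → OrbitWithin L d e
  inOrbit⇒orbitWithin {d = d} (p , per) (k , eq) with iter-periodic G φ per k
  ... | m , m<1+p , eq′ =
    fromℕ< m<L , trans (cong (λ i → iter G φ i d) (toℕ-fromℕ< m<L)) (trans (sym eq′) eq)
    where m<L = ≤-trans m<1+p (toℕ<n p)

  faceCount : ∀ {F L} (rep : Fin F → Dart G) → (∀ i → IsDart G (rep i)) →
              (∀ i → FaceLength≤ L (rep i)) →
              (∀ i j → OrbitWithin L (rep i) (rep j) → i ≡ j) →
              (∀ d → IsDart G d → ∃[ i ] OrbitWithin L (rep i) d) →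
              FaceCount G rot F
  faceCount rep rep-dart rep-short separated covering =
    rep , rep-dart ,
    (λ i j o → separated i j (inOrbit⇒orbitWithin (rep-short i) o)) ,
    (λ d d-dart → Product.map₂ orbitWithin⇒inOrbit (covering d d-dart))

  BoundedBy : (Fin (n G) → Fin (n G) → Set) → Dart G → Set
  BoundedBy C d = IsDart G d × (∀ u w → E G u w →
    (C u w → InOrbit G rot d (u , w) ⊎ InOrbit G rot d (w , u))
    × (InOrbit G rot d (u , w) ⊎ InOrbit G rot d (w , u) → C u w))

  OnFaceWithin : ℕ → Dart G → Fin (n G) → Fin (n G) → Set
  OnFaceWithin L d u w = OrbitWithin L d (u , w) ⊎ OrbitWithin L d (w , u)

  OnFaceIff : (Fin (n G) → Fin (n G) → Set) → ℕ → Dart G → Fin (n G) → Fin (n G) → Set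
  OnFaceIff C L d u w = (C u w → OnFaceWithin L d u w) × (OnFaceWithin L d u w → C u w)

  boundedBy-within : ∀ {C L d} → FaceLength≤ L d → IsDart G d →
    (∀ u w → E G u w → OnFaceIff C L d u w) → BoundedBy C d
  boundedBy-within short d-dart bounded = d-dart , λ u w e →
    Sum.map orbitWithin⇒inOrbit orbitWithin⇒inOrbit ∘ proj₁ (bounded u w e) ,
    proj₂ (bounded u w e) ∘ Sum.map (inOrbit⇒orbitWithin short) (inOrbit⇒orbitWithin short)

  SideStep : (Fin (n G) → Fin (n G) → Set) → Dart G → Dart G → Set
  SideStep C d e = IsDart G d × IsDart G e ×
    (φ d ≡ e ⊎ φ e ≡ d ⊎ (e ≡ (proj₂ d , proj₁ d) × ¬ C (proj₁ d) (proj₂ d)))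

  sideStep-region : ∀ {C b} (region : Dart G → ℕ) →
    (∀ d → IsDart G d → region (φ d) ≡ region d) →
    (∀ u w → E G u w → ¬ C u w → region (u , w) ≤ b → region (w , u) ≤ b) →
    ∀ {d e} → Star (SideStep C) d e → region d ≤ b → region e ≤ b
  sideStep-region {C} {b} region region-φ across = go
    where
    preserved : ∀ {d e} → SideStep C d e → region d ≤ b → region e ≤ b
    preserved (d-dart , _ , inj₁ refl) = subst (_≤ b) (sym (region-φ _ d-dart))
    preserved (_ , e-dart , inj₂ (inj₁ refl)) = subst (_≤ b) (region-φ _ e-dart)
    preserved (d-dart , _ , inj₂ (inj₂ (refl , ¬C))) = across _ _ d-dart ¬C

    go : ∀ {d e} → Star (SideStep C) d e → region d ≤ b → region e ≤ b
    go ε = λ r → r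
    go (s ◅ ss) = go ss ∘ preserved s

module Suppression (G : Graph) (P : Fin (n G) → Set) (B : Graph) (s : SuppressesTo G P B) where

  private
    f : Fin (n B) → Fin (n G)
    f = proj₁ s

    onto : ∀ v → Branch G P v → ∃[ a ] f a ≡ v
    onto = proj₁ (proj₂ (proj₂ (proj₂ s)))

    thread⇒edge : ∀ a b mid → Thread G P (f a) (f b) mid → E B a b
    thread⇒edge = proj₁ (proj₂ (proj₂ (proj₂ (proj₂ (proj₂ s)))))

  branch-preimage : ∀ v → Branch G P v → Fin (n B)
  branch-preimage v b = proj₁ (onto v b)

  thread-edge : ∀ u w mid (bu : Branch G P u) (bw : Branch G P w) →
                Thread G P u w mid → E B (branch-preimage u bu) (branch-preimage w bw)
  thread-edge u w mid bu bw t = thread⇒edge _ _ mid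
    (subst₂ (λ x y → Thread G P x y mid) (sym (proj₂ (onto u bu))) (sym (proj₂ (onto w bw))) t)

fin2-≢-≢⇒≡ : {x y z : Fin 2} → x ≢ y → y ≢ z → x ≡ z
fin2-≢-≢⇒≡ {zero}     {zero}                x≢y _   = ⊥-elim (x≢y refl)
fin2-≢-≢⇒≡ {zero}     {suc zero} {zero}     _   _   = refl
fin2-≢-≢⇒≡ {zero}     {suc zero} {suc zero} _   y≢z = ⊥-elim (y≢z refl)
fin2-≢-≢⇒≡ {suc zero} {zero}     {zero}     _   y≢z = ⊥-elim (y≢z refl)
fin2-≢-≢⇒≡ {suc zero} {zero}     {suc zero} _   _   = refl
fin2-≢-≢⇒≡ {suc zero} {suc zero}            x≢y _   = ⊥-elim (x≢y refl)

bipartite-no-pentagon : (B : Graph) → Bipartite B → ∀ {a₁ a₂ a₃ a₄ a₅} →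
  E B a₁ a₂ → E B a₂ a₃ → E B a₃ a₄ → E B a₄ a₅ → E B a₅ a₁ → ⊥
bipartite-no-pentagon B (c , proper) e₁₂ e₂₃ e₃₄ e₄₅ e₅₁ =
  proper _ _ e₅₁ (sym (trans (fin2-≢-≢⇒≡ (proper _ _ e₁₂) (proper _ _ e₂₃))
                              (fin2-≢-≢⇒≡ (proper _ _ e₃₄) (proper _ _ e₄₅))))

cycSucc-≢ : (k : Fin 3) → cycSucc k ≢ k
cycSucc-≢ zero ()
cycSucc-≢ (suc zero) ()
cycSucc-≢ (suc (suc zero)) ()

cycSucc³ : (k : Fin 3) → cycSucc (cycSucc (cycSucc k)) ≡ k
cycSucc³ zero = refl
cycSucc³ (suc zero) = refl
cycSucc³ (suc (suc zero)) = refl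

module CubicTable {n : ℕ} (nb : Fin n → Fin 3 → Fin n)
  (nb-sym : ∀ u k → ∃[ j ] nb (nb u k) j ≡ u)
  (nb-loopless : ∀ u k → nb u k ≢ u) where

  Adj : Fin n → Fin n → Set
  Adj u w = ∃[ k ] nb u k ≡ w

  adj? : ∀ u w → Dec (Adj u w)
  adj? u w = any? λ k → nb u k ≟ w

  ∀-adj : ∀ {Q : Fin n → Fin n → Set} → (∀ u k → Q u (nb u k)) → ∀ u w → Adj u w → Q u w
  ∀-adj q u _ (k , refl) = q u k

  graph : Graph
  graph = record { n = n ; E = Adj ; sym = adj-sym ; irrefl = adj-irrefl }
    where
    adj-sym : ∀ {u w} → Adj u w → Adj w u
    adj-sym (k , refl) = nb-sym _ k

    adj-irrefl : ∀ {u} → ¬ Adj u u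
    adj-irrefl (k , e) = nb-loopless _ k e

  bipartite : (c : Fin n → Fin 2) → (∀ u k → c u ≢ c (nb u k)) → Bipartite graph
  bipartite c proper = c , ∀-adj proper

  -- The value at a non-neighbour w is junk.
  rotation : Fin n → Fin n → Fin n
  rotation u w with any? (λ k → nb u k ≟ w)
  ... | yes (k , _) = nb u (cycSucc k)
  ... | no _ = w

  module _ (nb-inj : ∀ u i j → nb u i ≡ nb u j → i ≡ j) where

    cubic : Cubic graph
    cubic u = nb u , nb-inj u , (λ k → tt , k , refl) , λ w _ e → e

    rotation-nb : ∀ u k → rotation u (nb u k) ≡ nb u (cycSucc k)
    rotation-nb u k with any? (λ j → nb u j ≟ nb u k)
    ... | yes (j , e) = cong (λ i → nb u (cycSucc i)) (nb-inj u j k e)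
    ... | no ¬adj = ⊥-elim (¬adj (k , refl))

    isRotation : IsRotation graph rotation
    isRotation u = ∀-adj rotates u
      where
      rotates : ∀ u k → Adj u (rotation u (nb u k)) × rotation u (nb u k) ≢ nb u k
                × rotation u (rotation u (rotation u (nb u k))) ≡ nb u k
      rotates u k =
        (cycSucc k , sym (rotation-nb u k)) ,
        (λ e → cycSucc-≢ k (nb-inj u _ _ (trans (sym (rotation-nb u k)) e))) ,
        (begin
          rotation u (rotation u (rotation u (nb u k)))  ≡⟨ cong (rotation u ∘ rotation u) (rotation-nb u k) ⟩
          rotation u (rotation u (nb u (cycSucc k)))     ≡⟨ cong (rotation u) (rotation-nb u (cycSucc k)) ⟩
          rotation u (nb u (cycSucc (cycSucc k)))        ≡⟨ rotation-nb u (cycSucc (cycSucc k)) ⟩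
          nb u (cycSucc (cycSucc (cycSucc k)))           ≡⟨ cong (nb u) (cycSucc³ k) ⟩
          nb u k                                         ∎)
        where open ≡-Reasoning

  module Search {P : Fin n → Set} (P? : Decidable P) where

    isRoot : Fin n → Fin n → Bool
    isRoot r v = ⌊ v ≟ r ⌋ ∧ ⌊ P? v ⌋

    joins : Vec Bool n → Fin n → Bool
    joins S v = lookup S v ∨ (⌊ P? v ⌋ ∧ ⌊ any? (λ k → T? (lookup S (nb v k))) ⌋)

    searched : ℕ → Fin n → Vec Bool n
    searched s r = iter graph (tabulate ∘ joins) s (tabulate (isRoot r))

    LeadsTo : Fin n → Vec Bool n → Set
    LeadsTo r S = ∀ v → T (lookup S v) → Walk graph P v r

    T-lookup∘tabulate : ∀ {f : Fin n → Bool} v → T (lookup (tabulate f) v) → T (f v)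
    T-lookup∘tabulate {f} v = subst T (Vec.lookup∘tabulate f v)

    isRoot-leads : ∀ r → LeadsTo r (tabulate (isRoot r))
    isRoot-leads r v marked with Equivalence.to Bool.T-∧ (T-lookup∘tabulate v marked)
    ... | v≡r , Pv with toWitness {a? = v ≟ r} v≡r
    ... | refl = here (toWitness {a? = P? v} Pv)

    joins-leads : ∀ {r S} → LeadsTo r S → LeadsTo r (tabulate (joins S))
    joins-leads {r} {S} leads v marked with Equivalence.to Bool.T-∨ (T-lookup∘tabulate v marked)
    ... | inj₁ old = leads v old
    ... | inj₂ new with Equivalence.to Bool.T-∧ new
    ...   | Pv , towards with toWitness {a? = any? (λ k → T? (lookup S (nb v k)))} towards
    ...     | k , next = step (toWitness {a? = P? v} Pv) (k , refl) (leads (nb v k) next)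

    searched-leads : ∀ s r → LeadsTo r (searched s r)
    searched-leads zero r = isRoot-leads r
    searched-leads (suc s) r = joins-leads {S = searched s r} (searched-leads s r)

    connectedOn-search : ∀ s → ∃[ r ] searched s r ≡ tabulate (λ v → ⌊ P? v ⌋) →
                         ConnectedOn graph P
    connectedOn-search s (r , complete) u w Pu Pw = walk-++ (to-root u Pu) (walk-reverse (to-root w Pw))
      where
      to-root : ∀ v → P v → Walk graph P v r
      to-root v Pv = searched-leads s r v (subst (λ S → T (lookup S v)) (sym complete)
        (subst T (sym (Vec.lookup∘tabulate (λ v → ⌊ P? v ⌋) v)) (fromWitness Pv)))

  avoiding? : (a b : Fin n) → Decidable (λ z → z ≢ a × z ≢ b)
  avoiding? a b z = ¬? (z ≟ a) ×-dec ¬? (z ≟ b)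

  threeConnected-search : 3 < n → (s : ℕ) →
    (∀ a b → ∃[ r ] Search.searched (avoiding? a b) s r ≡ tabulate (λ v → ⌊ avoiding? a b v ⌋)) →
    ThreeConnected graph
  threeConnected-search 3<n s complete =
    3<n , λ a b → Search.connectedOn-search (avoiding? a b) s (complete a b)

V : Set
V = Fin 24

-- Row v lists the neighbours of v in their cyclic order around v in the plane embedding.
table : Vec (Vec V 3) 24
table =
  (# 4 ∷ # 1 ∷ # 3 ∷ []) ∷
  (# 7 ∷ # 2 ∷ # 0 ∷ []) ∷
  (# 10 ∷ # 3 ∷ # 1 ∷ []) ∷
  (# 11 ∷ # 0 ∷ # 2 ∷ []) ∷
  (# 5 ∷ # 0 ∷ # 11 ∷ []) ∷
  (# 12 ∷ # 6 ∷ # 4 ∷ []) ∷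
  (# 13 ∷ # 7 ∷ # 5 ∷ []) ∷
  (# 8 ∷ # 1 ∷ # 6 ∷ []) ∷
  (# 17 ∷ # 9 ∷ # 7 ∷ []) ∷
  (# 18 ∷ # 10 ∷ # 8 ∷ []) ∷
  (# 11 ∷ # 2 ∷ # 9 ∷ []) ∷
  (# 4 ∷ # 3 ∷ # 10 ∷ []) ∷
  (# 13 ∷ # 5 ∷ # 19 ∷ []) ∷
  (# 14 ∷ # 6 ∷ # 12 ∷ []) ∷
  (# 20 ∷ # 15 ∷ # 13 ∷ []) ∷
  (# 21 ∷ # 16 ∷ # 14 ∷ []) ∷
  (# 22 ∷ # 17 ∷ # 15 ∷ []) ∷
  (# 18 ∷ # 8 ∷ # 16 ∷ []) ∷
  (# 19 ∷ # 9 ∷ # 17 ∷ []) ∷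
  (# 23 ∷ # 12 ∷ # 18 ∷ []) ∷
  (# 21 ∷ # 14 ∷ # 23 ∷ []) ∷
  (# 22 ∷ # 15 ∷ # 20 ∷ []) ∷
  (# 23 ∷ # 16 ∷ # 21 ∷ []) ∷
  (# 20 ∷ # 19 ∷ # 22 ∷ []) ∷ []

nb : V → Fin 3 → V
nb u k = lookup (lookup table u) k

nb-sym : ∀ u k → ∃[ j ] nb (nb u k) j ≡ u
nb-sym = from-yes (all? λ u → all? λ k → any? λ j → nb (nb u k) j ≟ u)

nb-loopless : ∀ u k → nb u k ≢ u
nb-loopless = from-yes (all? λ u → all? λ k → ¬? (nb u k ≟ u))

nb-injective : ∀ u i j → nb u i ≡ nb u j → i ≡ j
nb-injective = from-yes (all? λ u → all? λ i → all? λ j → nb u i ≟ nb u j →-dec i ≟ j)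

open CubicTable nb nb-sym nb-loopless

colour : V → Fin 2
colour = lookup (# 0 ∷ # 1 ∷ # 0 ∷ # 1 ∷
                 # 1 ∷ # 0 ∷ # 1 ∷ # 0 ∷ # 1 ∷ # 0 ∷ # 1 ∷ # 0 ∷
                 # 1 ∷ # 0 ∷ # 1 ∷ # 0 ∷ # 1 ∷ # 0 ∷ # 1 ∷ # 0 ∷
                 # 0 ∷ # 1 ∷ # 0 ∷ # 1 ∷ [])

bipartite-graph : Bipartite graph
bipartite-graph = bipartite colour (from-yes (all? λ u → all? λ k → ¬? (colour u ≟ colour (nb u k))))

threeConnected-graph : ThreeConnected graph
threeConnected-graph = threeConnected-search (s≤s (s≤s (s≤s (s≤s z≤n)))) 8
  (from-yes (all? λ a → all? λ b → any? λ r →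
    Vec.≡-dec Bool._≟_ (Search.searched (avoiding? a b) 8 r) (tabulate λ v → ⌊ avoiding? a b v ⌋)))

open Faces graph rotation

_≟ᵈ_ : (d e : Dart graph) → Dec (d ≡ e)
_≟ᵈ_ = Product.≡-dec _≟_ _≟_

orbitWithin? : ∀ L d e → Dec (OrbitWithin L d e)
orbitWithin? L d e = any? λ m → iter graph (faceSucc graph rotation) (toℕ m) d ≟ᵈ e

faceLength≤? : ∀ L d → Dec (FaceLength≤ L d)
faceLength≤? L d = any? λ p → iter graph (faceSucc graph rotation) (suc (toℕ p)) d ≟ᵈ d

face : Fin 14 → Dart graph
face = lookup ((# 0 , # 4) ∷ (# 0 , # 1) ∷ (# 0 , # 3) ∷ (# 1 , # 2) ∷ (# 2 , # 3) ∷
               (# 4 , # 5) ∷ (# 5 , # 6) ∷ (# 6 , # 7) ∷ (# 8 , # 9) ∷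
               (# 12 , # 13) ∷ (# 14 , # 15) ∷ (# 15 , # 16) ∷ (# 16 , # 17) ∷
               (# 20 , # 21) ∷ [])

spherical-graph : Spherical graph rotation
spherical-graph = isRotation nb-injective , 14 , faces , refl
  where
  faces : FaceCount graph rotation 14
  faces = faceCount face
    (from-yes (all? λ i → adj? (proj₁ (face i)) (proj₂ (face i))))
    (from-yes (all? λ i → faceLength≤? 8 (face i)))
    (from-yes (all? λ i → all? λ j → orbitWithin? 8 (face i) (face j) →-dec i ≟ j))
    (λ (u , w) → ∀-adj {Q = λ u w → ∃[ i ] OrbitWithin 8 (face i) (u , w)}
       (from-yes (all? λ u → all? λ k → any? λ i → orbitWithin? 8 (face i) (u , nb u k))) u w)

barnette : IsBarnette graph
barnette = cubic nb-injective , threeConnected-graph , (rotation , spherical-graph) , bipartite-graph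

len : Fin 4 → ℕ
len zero = 4
len (suc zero) = 8
len (suc (suc zero)) = 8
len (suc (suc (suc zero))) = 4

cycleTable : (k : Fin 4) → Vec V (len k)
cycleTable zero = # 0 ∷ # 1 ∷ # 2 ∷ # 3 ∷ []
cycleTable (suc zero) = # 4 ∷ # 5 ∷ # 6 ∷ # 7 ∷ # 8 ∷ # 9 ∷ # 10 ∷ # 11 ∷ []
cycleTable (suc (suc zero)) = # 12 ∷ # 13 ∷ # 14 ∷ # 15 ∷ # 16 ∷ # 17 ∷ # 18 ∷ # 19 ∷ []
cycleTable (suc (suc (suc zero))) = # 20 ∷ # 21 ∷ # 22 ∷ # 23 ∷ []

cyc : (k : Fin 4) → Fin (len k) → V
cyc k = lookup (cycleTable k)

OnCycle : Fin 4 → V → Set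
OnCycle k v = ∃[ i ] cyc k i ≡ v

onCycle? : ∀ k v → Dec (OnCycle k v)
onCycle? k v = any? λ i → cyc k i ≟ v

CycleEdge : Fin 4 → V → V → Set
CycleEdge k u w = ∃[ i ] ((cyc k i ≡ u × cyc k (cycSucc i) ≡ w) ⊎ (cyc k i ≡ w × cyc k (cycSucc i) ≡ u))

cycleEdge? : ∀ k u w → Dec (CycleEdge k u w)
cycleEdge? k u w = any? λ i →
  (cyc k i ≟ u ×-dec cyc k (cycSucc i) ≟ w) ⊎-dec (cyc k i ≟ w ×-dec cyc k (cycSucc i) ≟ u)

cycleIndex : V → ℕ
cycleIndex = lookup (0 ∷ 0 ∷ 0 ∷ 0 ∷
                     1 ∷ 1 ∷ 1 ∷ 1 ∷ 1 ∷ 1 ∷ 1 ∷ 1 ∷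
                     2 ∷ 2 ∷ 2 ∷ 2 ∷ 2 ∷ 2 ∷ 2 ∷ 2 ∷
                     3 ∷ 3 ∷ 3 ∷ 3 ∷ [])

Forward : V → V → Set
Forward u w = ∃[ k ] ∃[ i ] cyc k i ≡ u × cyc k (cycSucc i) ≡ w

forward? : ∀ u w → Dec (Forward u w)
forward? u w = any? λ k → any? λ i → cyc k i ≟ u ×-dec cyc k (cycSucc i) ≟ w

-- The index of the annulus containing the face of the dart, A₀ being the face inside C₀
-- and A₄ the outer face.
region : Dart graph → ℕ
region (u , w) = if ⌊ forward? u w ⌋ then suc (cycleIndex u) else cycleIndex u ⊔ cycleIndex w

outerDart : Dart graph
outerDart = # 20 , # 21

bounds? : ∀ k d →
  Dec (FaceLength≤ 8 d × Adj (proj₁ d) (proj₂ d) × ∀ u t → OnFaceIff (CycleEdge k) 8 d u (nb u t))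
bounds? k d = faceLength≤? 8 d ×-dec adj? (proj₁ d) (proj₂ d) ×-dec all? λ u → all? λ t →
  (cycleEdge? k u (nb u t) →-dec onFace? u (nb u t)) ×-dec (onFace? u (nb u t) →-dec cycleEdge? k u (nb u t))
  where
  onFace? : ∀ u w → Dec (OnFaceWithin 8 d u w)
  onFace? u w = orbitWithin? 8 d (u , w) ⊎-dec orbitWithin? 8 d (w , u)

boundedBy : ∀ k d → {True (bounds? k d)} → BoundedBy (CycleEdge k) d
boundedBy k d {ok} =
  let short , d-dart , bounded = toWitness {a? = bounds? k d} ok
  in  boundedBy-within short d-dart (∀-adj {Q = OnFaceIff (CycleEdge k) 8 d} bounded)

region-φ : ∀ d → IsDart graph d → region (faceSucc graph rotation d) ≡ region d
region-φ (u , w) = ∀-adj {Q = λ u w → region (faceSucc graph rotation (u , w)) ≡ region (u , w)}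
  (from-yes (all? λ u → all? λ t →
    region (faceSucc graph rotation (u , nb u t)) ≟ℕ region (u , nb u t))) u w

region-across : ∀ k u w → Adj u w → ¬ CycleEdge k u w →
                region (u , w) ≤ toℕ k → region (w , u) ≤ toℕ k
region-across k =
  ∀-adj {Q = λ u w → ¬ CycleEdge k u w → region (u , w) ≤ toℕ k → region (w , u) ≤ toℕ k}
    (from-yes (all? λ k → all? λ u → all? λ t →
      ¬? (cycleEdge? k u (nb u t)) →-dec
      region (u , nb u t) ≤? toℕ k →-dec region (nb u t , u) ≤? toℕ k) k)

region-inner : ∀ (j : Fin 3) i w → Adj (cyc (inject₁ j) i) w →
               region (cyc (inject₁ j) i , w) ≤ toℕ (suc j)
region-inner j i _ (t , refl) =
  from-yes (all? λ j → all? λ i → all? λ t →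
    region (cyc (inject₁ j) i , nb (cyc (inject₁ j) i) t) ≤? toℕ (suc j)) j i t

region-outer : ∀ (k : Fin 4) → ¬ region outerDart ≤ toℕ k
region-outer = from-yes (all? λ (k : Fin 4) → ¬? (region outerDart ≤? toℕ k))

cycles-nested : ∀ (j : Fin 3) i w → Adj (cyc (inject₁ j) i) w →
                ¬ Star (SideStep (CycleEdge (suc j))) (cyc (inject₁ j) i , w) outerDart
cycles-nested j i w e path =
  region-outer (suc j) (sideStep-region region region-φ (region-across (suc j)) path (region-inner j i w e))

adb : ADB graph 3
adb = record
  { rot = rotation
  ; spherical = spherical-graph
  ; outerDart = outerDart
  ; outerIsDart = from-yes (adj? (# 20) (# 21))
  ; len = len
  ; len≥3 = from-yes (all? λ k → 3 ≤? len k)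
  ; cyc = cyc
  ; cyc-inj = from-yes (all? λ k → all? λ i → all? λ j → cyc k i ≟ cyc k j →-dec i ≟ j)
  ; cyc-adj = from-yes (all? λ k → all? λ i → adj? (cyc k i) (cyc k (cycSucc i)))
  ; disjoint = from-yes (all? λ k → all? λ l → all? λ i → all? λ j → cyc k i ≟ cyc l j →-dec k ≟ l)
  ; cover = from-yes (all? λ v → any? λ k → onCycle? k v)
  ; edges = ∀-adj (from-yes (all? λ u → all? λ t →
      (any? λ k → cycleEdge? k u (nb u t)) ⊎-dec
      (any? λ j → (onCycle? (inject₁ j) u ×-dec onCycle? (suc j) (nb u t)) ⊎-dec
                  (onCycle? (suc j) u ×-dec onCycle? (inject₁ j) (nb u t)))))
  ; innerFace = (# 0 , # 3) , boundedBy zero (# 0 , # 3)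
  ; outerFace = boundedBy (# 3) outerDart
  ; nested = cycles-nested
  }

Inside : V → Set
Inside = Inner adb (# 2)

inside? : ∀ v → Dec (Inside v)
inside? v = any? λ l → toℕ l ≤? 2 ×-dec onCycle? l v

branch? : ∀ v → Dec (Inside v × ∀ k → Inside (nb v k))
branch? v = inside? v ×-dec all? λ k → inside? (nb v k)

branch : ∀ v → {True (branch? v)} → Branch graph Inside v
branch v {ok} =
  let v-inside , nbs-inside = toWitness {a? = branch? v} ok
      degree-three = degIs-restrict graph v (cubic nb-injective v) (λ _ → tt) nbs-inside
  in  v-inside , λ degree-two → 3≢2 (degIs-unique graph v degree-three degree-two)
  where
  3≢2 : ¬ 3 ≡ 2
  3≢2 ()

degree-two? : ∀ v → Dec (¬ Inside (nb v zero) × ∀ i → Inside (nb v (suc i)))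
degree-two? v = ¬? (inside? (nb v zero)) ×-dec all? λ i → inside? (nb v (suc i))

degree-two : ∀ v → {True (degree-two? v)} → DegIs graph Inside v 2
degree-two v {ok} =
  let first-outside , others-inside = toWitness {a? = degree-two? v} ok
  in  degIs-drop graph v (cubic nb-injective v) (λ _ → tt) first-outside others-inside

he? : ∀ u w → Dec (HE graph Inside u w)
he? u w = inside? u ×-dec inside? w ×-dec adj? u w

thread? : ∀ u w mid → Dec (Linked (HE graph Inside) (u ∷ mid ++ w ∷ []) × Unique (u ∷ mid ++ w ∷ []))
thread? u w mid = linked? he? (u ∷ mid ++ w ∷ []) ×-dec Unique.unique? _≟_ (u ∷ mid ++ w ∷ [])

thread : ∀ u w mid → {True (thread? u w mid)} →
         All (λ v → DegIs graph Inside v 2) mid → Thread graph Inside u w mid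
thread u w mid {ok} mid-degree-two =
  let linked , unique = toWitness {a? = thread? u w mid} ok
  in  linked , mid-degree-two , unique

not-barnette : ¬ SuppressesToBarnette graph Inside
not-barnette (B , (_ , _ , _ , B-bipartite) , s) =
  bipartite-no-pentagon B B-bipartite
    (edge (# 13) (# 17) (# 14 ∷ # 15 ∷ # 16 ∷ [])
      (degree-two (# 14) ∷ degree-two (# 15) ∷ degree-two (# 16) ∷ []))
    (edge (# 17) (# 8) [] [])
    (edge (# 8) (# 7) [] [])
    (edge (# 7) (# 6) [] [])
    (edge (# 6) (# 13) [] [])
  where
  open Suppression graph Inside B s

  edge : ∀ u w mid {u-branch : True (branch? u)} {w-branch : True (branch? w)}
         {linked : True (thread? u w mid)} →
         All (λ v → DegIs graph Inside v 2) mid →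
         E B (branch-preimage u (branch u {u-branch})) (branch-preimage w (branch w {w-branch}))
  edge u w mid {linked = linked} mid-degree-two =
    thread-edge u w mid (branch u) (branch w) (thread u w mid {linked} mid-degree-two)

not-curve : ¬ SuppressesToCurve graph Inside
not-curve (_ , _ , degree-two-everywhere) =
  proj₂ (branch (# 0)) (degree-two-everywhere (# 0) (proj₁ (branch (# 0))))

not-annularConnected : ¬ AnnularConnected adb
not-annularConnected ac = not-at (ac (# 2))
  where
  not-at : ¬ ACAt adb (# 2)
  not-at (inj₁ (inner , _)) = not-barnette inner
  not-at (inj₂ (inj₁ (inner , _))) = not-barnette inner
  not-at (inj₂ (inj₂ (lift inner , _))) = not-curve inner

lemma2p1 : Σ Graph λ G → Σ ℕ λ x →
    2 < x × IsBarnette G × Σ (ADB G x) λ D → ¬ AnnularConnected D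
lemma2p1 = graph , 3 , s≤s (s≤s (s≤s z≤n)) , barnette , adb , not-annularConnected
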